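{- Let $G$ be a $k$-regular finite simple graph. If $H$ is a finite simple graph with $Q(H;x,y)=Q(G;x,y)$, then $H$ is $k$-regular.
   Context: For a finite simple graph $G=(V,E)$, the subgraph component polynomial is $Q(G;x,y)=\sum_{X\subseteq V} x^{|X|}y^{k(G[X])}$, where $G[X]$ is the induced subgraph on $X$ and $k(\cdot)$ denotes the number of connected components. -}

module Defs where

open import Data.Nat using (ℕ; zero; suc; _+_; _≡ᵇ_)
open import Data.Bool using (Bool; true; false; _∧_; _∨_; not; if_then_else_)
open import Data.Fin using (Fin; zero; suc; _<?_)
open import Data.Fin.Properties using (_≟_)
open import Data.List using (List; []; _∷_; _++_; map; concatMap; length; filter)
open import Data.Product using (_×_; _,_)
open import Relation.Nullary.Decidable using (⌊_⌋)
open import Relation.Binary.PropositionalEquality using (_≡_)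

record Graph (n : ℕ) : Set where
  field
    adj   : Fin n → Fin n → Bool
    sym   : ∀ u v → adj u v ≡ adj v u
    irrefl : ∀ v → adj v v ≡ false
open Graph public

VSet : ℕ → Set
VSet n = Fin n → Bool

anyFin : ∀ {n} → (Fin n → Bool) → Bool
anyFin {zero}  p = false
anyFin {suc n} p = p zero ∨ anyFin (λ i → p (suc i))

countFin : ∀ {n} → (Fin n → Bool) → ℕ
countFin {zero}  p = 0
countFin {suc n} p = (if p zero then 1 else 0) + countFin (λ i → p (suc i))

size : ∀ {n} → VSet n → ℕ
size X = countFin X

-- All subsets of Fin n (each exactly once).
subsets : (n : ℕ) → List (VSet n)
subsets zero    = (λ ()) ∷ []
subsets (suc n) = concatMap (λ s → ext false s ∷ ext true s ∷ []) (subsets n)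
  where
  ext : Bool → VSet n → VSet (suc n)
  ext b s zero    = b
  ext b s (suc i) = s i

reachWithin : ∀ {n} → Graph n → VSet n → ℕ → Fin n → Fin n → Bool
reachWithin G X zero    u v = ⌊ u ≟ v ⌋ ∧ X u
reachWithin G X (suc t) u v =
  reachWithin G X t u v ∨
  anyFin (λ w → reachWithin G X t u w ∧ adj G w v ∧ X v)

-- u and v lie in the same connected component of G[X]
-- (walks of length ≤ n suffice on n vertices).
connectedIn : ∀ {n} → Graph n → VSet n → Fin n → Fin n → Bool
connectedIn {n} G X = reachWithin G X n

-- k(G[X]): number of connected components of G[X], counted by their
-- least vertex (each component has exactly one least vertex).
components : ∀ {n} → Graph n → VSet n → ℕ
components G X =
  countFin (λ v → X v ∧ not (anyFin (λ u → ⌊ u <? v ⌋ ∧ connectedIn G X u v)))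

-- Coefficient of x^i y^j in Q(G;x,y) = Σ_{X ⊆ V} x^{|X|} y^{k(G[X])}.
Qcoeff : ∀ {n} → Graph n → ℕ → ℕ → ℕ
Qcoeff {n} G i j =
  length (filter (λ X → (size X Data.Nat.≟ i) Relation.Nullary.Decidable.×-dec
                          (components G X Data.Nat.≟ j))
                 (subsets n))

-- Equality of the bivariate polynomials Q(G;x,y) and Q(H;x,y)
-- (equality of all coefficients).
SameQ : ∀ {n m} → Graph n → Graph m → Set
SameQ G H = ∀ i j → Qcoeff G i j ≡ Qcoeff H i j

degree : ∀ {n} → Graph n → Fin n → ℕ
degree G v = countFin (adj G v)

Regular : ∀ {n} → Graph n → ℕ → Set
Regular G k = ∀ v → degree G v ≡ k

-- Write q_ij for the number of i-element vertex sets X with k(G[X]) = j (the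
-- coefficient of x^i y^j in Q).  The coefficients of Q determine
--   * the order:                 q_11 = n;
--   * the degree sum:            Σ_v d_v = 2 q_21;
--   * the sum of C(d_v,2):       Σ_v C(d_v,2) + 2 q_32 + 3 q_31 = (n-2) Σ_v d_v.
-- The last two are double counts.  Summing f(deg_{G[X]} v) over the (k+1)-sets
-- X and their vertices v equals summing, over v, the level sum
-- Σ_{|Y|=k, v∉Y} f(|Y ∩ N(v)|), which elementary binomial counting evaluates
-- (double-count, levelSum-*); and on two and three vertices the degrees of
-- G[X] are tied to its number of components by identities checked on the
-- finitely many graphs there (pair-identity, triple-identity).  If Q(H) = Q(G)
-- with G k-regular, H therefore has n vertices, Σ d_v = nk and
-- Σ C(d_v,2) = n C(k,2), so Σ (d_v - k)² = 0 and H is k-regular.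
module Submission where

open import Defs renaming (sym to adj-sym)

open import Data.Bool using (Bool; true; false; _∧_; _∨_; not; if_then_else_; T)
open import Data.Bool.Properties using (∧-conicalˡ; ∧-conicalʳ) renaming (_≟_ to _≟ᵇ_)
open import Data.Empty using (⊥-elim)
open import Data.Fin using (Fin; zero; suc; _<_; _<?_; punchIn)
open import Data.Fin.Patterns using (0F; 1F; 2F)
open import Data.Fin.Properties using (_≟_; all?; <-cmp; <-irrefl; <-asym)
open import Data.List using (List; []; _∷_; map; concatMap; lookup; length; filter)
open import Data.List.Properties using (map-cong)
open import Data.Nat using (ℕ; zero; suc; _+_; _*_; _≤_; z≤n; s≤s; _≡ᵇ_; _≤′_; ≤′-refl; ≤′-step)
open import Data.Nat.Combinatorics using (_C_; nC1≡n; nCk+nC[k+1]≡[n+1]C[k+1])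
open import Data.Nat.ListAction using () renaming (sum to sumList)
open import Data.Nat.Properties
  using (+-*-semiring; m≤n⇒m≤1+n; ≤⇒≤′; ≤-trans; n≤1+n; ≤-total; m≤n⇒∃[o]m+o≡n; +-identityʳ; +-comm;
         *-identityʳ; ≡ᵇ⇒≡; +-cancelˡ-≡; +-cancelʳ-≡; m+n≡0⇒m≡0; m+n≡0⇒n≡0; m*n≡0⇒m≡0∨n≡0)
open import Data.Nat.Tactic.RingSolver using (solve-∀)
open import Algebra.Properties.Semiring.Sum +-*-semiring
  using (sum; sum-cong-≗; sum-replicate-zero; ∑-distrib-+; ∑-comm; *-distribˡ-sum; *-distribʳ-sum)
open import Data.Product using (_×_; _,_; Σ-syntax; proj₁; proj₂)
open import Data.Sum using (inj₁; inj₂; [_,_]′)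
open import Data.Unit using (tt)
open import Function using (_∘_; id)
open import Relation.Binary using (tri<; tri≈; tri>)
open import Relation.Binary.PropositionalEquality
open import Relation.Nullary using (¬_; Dec; yes; no; does)
open import Relation.Nullary.Decidable using (⌊_⌋; True; toWitness)

⟦_⟧ : Bool → ℕ
⟦ b ⟧ = if b then 1 else 0

⟦∧⟧ : ∀ b {c} → ⟦ b ∧ c ⟧ ≡ (if b then ⟦ c ⟧ else 0)
⟦∧⟧ true  = refl
⟦∧⟧ false = refl

countFin≡sum : ∀ {n} (p : Fin n → Bool) → countFin p ≡ sum (λ v → ⟦ p v ⟧)
countFin≡sum {zero}  p = refl
countFin≡sum {suc n} p = cong (⟦ p zero ⟧ +_) (countFin≡sum (p ∘ suc))

countFin-cong : ∀ {n} {p q : Fin n → Bool} → (∀ v → p v ≡ q v) → countFin p ≡ countFin q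
countFin-cong {zero}  e = refl
countFin-cong {suc n} e = cong₂ _+_ (cong ⟦_⟧ (e zero)) (countFin-cong (e ∘ suc))

anyFin-cong : ∀ {n} {p q : Fin n → Bool} → (∀ v → p v ≡ q v) → anyFin p ≡ anyFin q
anyFin-cong {zero}  e = refl
anyFin-cong {suc n} e = cong₂ _∨_ (e zero) (anyFin-cong (e ∘ suc))

anyFin-witness : ∀ {n} (p : Fin n → Bool) → anyFin p ≡ true → Σ[ w ∈ Fin n ] p w ≡ true
anyFin-witness {suc n} p h with p zero in p0
... | true  = zero , p0
... | false with anyFin-witness (p ∘ suc) h
...   | w , pw = suc w , pw

false-below : ∀ {b c} → (b ≡ true → c ≡ true) → c ≡ false → b ≡ false
false-below {false} _   _ = refl
false-below {true}  b⇒c c≡false with () ← trans (sym (b⇒c refl)) c≡false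

enum : ∀ {n} (X : VSet n) → Fin (size X) → Fin n
enum {suc n} X i with X zero
enum {suc n} X zero    | true  = zero
enum {suc n} X (suc i) | true  = suc (enum (X ∘ suc) i)
enum {suc n} X i       | false = suc (enum (X ∘ suc) i)

enum-∈ : ∀ {n} (X : VSet n) (i : Fin (size X)) → X (enum X i) ≡ true
enum-∈ {suc n} X i with X zero in X0
enum-∈ {suc n} X zero    | true  = X0
enum-∈ {suc n} X (suc i) | true  = enum-∈ (X ∘ suc) i
enum-∈ {suc n} X i       | false = enum-∈ (X ∘ suc) i

enum-mono : ∀ {n} (X : VSet n) {i j : Fin (size X)} → i < j → enum X i < enum X j
enum-mono {suc n} X {i} {j} i<j with X zero
enum-mono {suc n} X {zero}  {suc j} i<j       | true  = s≤s z≤n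
enum-mono {suc n} X {suc i} {suc j} (s≤s i<j) | true  = s≤s (enum-mono (X ∘ suc) i<j)
enum-mono {suc n} X {i}     {j}     i<j       | false = s≤s (enum-mono (X ∘ suc) i<j)

sum-over-set : ∀ {n} (X : VSet n) (h : Fin n → ℕ) →
  sum (λ v → if X v then h v else 0) ≡ sum (h ∘ enum X)
sum-over-set {zero}  X h = refl
sum-over-set {suc n} X h with X zero
... | true  = cong (h zero +_) (sum-over-set (X ∘ suc) (h ∘ suc))
... | false = sum-over-set (X ∘ suc) (h ∘ suc)

count-over-set : ∀ {n} (X : VSet n) (p : Fin n → Bool) →
  countFin (λ v → X v ∧ p v) ≡ countFin (p ∘ enum X)
count-over-set X p = begin
  countFin (λ v → X v ∧ p v)               ≡⟨ countFin≡sum (λ v → X v ∧ p v) ⟩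
  sum (λ v → ⟦ X v ∧ p v ⟧)                 ≡⟨ sum-cong-≗ (λ v → ⟦∧⟧ (X v)) ⟩
  sum (λ v → if X v then ⟦ p v ⟧ else 0)   ≡⟨ sum-over-set X (⟦_⟧ ∘ p) ⟩
  sum (λ i → ⟦ p (enum X i) ⟧)              ≡⟨ countFin≡sum (p ∘ enum X) ⟨
  countFin (p ∘ enum X)                    ∎
  where open ≡-Reasoning

any-over-set : ∀ {n} (X : VSet n) (p : Fin n → Bool) → (∀ v → p v ≡ true → X v ≡ true) →
  anyFin p ≡ anyFin (p ∘ enum X)
any-over-set {zero}  X p p⊆X = refl
any-over-set {suc n} X p p⊆X with X zero in X0
... | true  = cong (p zero ∨_) (any-over-set (X ∘ suc) (p ∘ suc) (p⊆X ∘ suc))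
... | false rewrite false-below (p⊆X zero) X0 = any-over-set (X ∘ suc) (p ∘ suc) (p⊆X ∘ suc)

size≤ : ∀ {n} (X : VSet n) → size X ≤ n
size≤ {zero}  X = z≤n
size≤ {suc n} X with X zero
... | true  = s≤s (size≤ (X ∘ suc))
... | false = m≤n⇒m≤1+n (size≤ (X ∘ suc))

⌊⌋-true : ∀ {A : Set} (a? : Dec A) → A → ⌊ a? ⌋ ≡ true
⌊⌋-true (yes _) _ = refl
⌊⌋-true (no ¬a) a = ⊥-elim (¬a a)

⌊⌋-false : ∀ {A : Set} (a? : Dec A) → ¬ A → ⌊ a? ⌋ ≡ false
⌊⌋-false (yes a) ¬a = ⊥-elim (¬a a)
⌊⌋-false (no _)  _  = refl

module StrictlyIncreasing {k n} (f : Fin k → Fin n) (mono : ∀ {i j} → i < j → f i < f j) where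

  preserves-< : ∀ i j → ⌊ f i <? f j ⌋ ≡ ⌊ i <? j ⌋
  preserves-< i j with <-cmp i j
  ... | tri< i<j _ _ = trans (⌊⌋-true (f i <? f j) (mono i<j)) (sym (⌊⌋-true (i <? j) i<j))
  ... | tri≈ _ refl _ = trans (⌊⌋-false (f i <? f i) (<-irrefl refl)) (sym (⌊⌋-false (i <? i) (<-irrefl refl)))
  ... | tri> _ _ j<i = trans (⌊⌋-false (f i <? f j) (<-asym (mono j<i))) (sym (⌊⌋-false (i <? j) (<-asym j<i)))

  preserves-≟ : ∀ i j → ⌊ f i ≟ f j ⌋ ≡ ⌊ i ≟ j ⌋
  preserves-≟ i j with <-cmp i j
  ... | tri< i<j _ _ = trans (⌊⌋-false (f i ≟ f j) (λ e → <-irrefl e (mono i<j))) (sym (⌊⌋-false (i ≟ j) (λ e → <-irrefl e i<j)))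
  ... | tri≈ _ refl _ = trans (⌊⌋-true (f i ≟ f i) refl) (sym (⌊⌋-true (i ≟ i) refl))
  ... | tri> _ _ j<i = trans (⌊⌋-false (f i ≟ f j) (λ e → <-irrefl (sym e) (mono j<i))) (sym (⌊⌋-false (i ≟ j) (λ e → <-irrefl (sym e) j<i)))

full : ∀ {k} → VSet k
full _ = true

-- |Y ∩ S|; in particular common X (adj G v) is the degree of v in G[X].
common : ∀ {n} → VSet n → VSet n → ℕ
common Y S = countFin (λ i → Y i ∧ S i)

degreeSum : ∀ {n} → (ℕ → ℕ) → Graph n → VSet n → ℕ
degreeSum f G X = sum (λ v → if X v then f (common X (adj G v)) else 0)

classCount : ∀ {k} → (Fin k → Fin k → Bool) → ℕ
classCount r = countFin (λ v → not (anyFin (λ u → ⌊ u <? v ⌋ ∧ r u v)))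

reach-inside : ∀ {n} (G : Graph n) (X : VSet n) t u v →
  reachWithin G X t u v ≡ true → X u ≡ true × X v ≡ true
reach-inside G X zero u v h with u ≟ v
reach-inside G X zero u .u h | yes refl = h , h
reach-inside G X zero u v () | no _
reach-inside G X (suc t) u v h with reachWithin G X t u v in r
... | true  = reach-inside G X t u v r
... | false with anyFin-witness _ h
...   | w , step = proj₁ (reach-inside G X t u w (∧-conicalˡ _ _ step))
                 , ∧-conicalʳ (adj G w v) _ (∧-conicalʳ (reachWithin G X t u w) _ step)

induced : ∀ {n} (G : Graph n) (X : VSet n) → Graph (size X)
induced G X = record
  { adj    = λ i j → adj G (enum X i) (enum X j)
  ; sym    = λ i j → adj-sym G (enum X i) (enum X j)
  ; irrefl = λ i → irrefl G (enum X i)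
  }

-- Reachability, components and degree sums of G[X] are those of the
-- relabelled graph; note that connectedness keeps the walk bound n.
module InducedSubgraph {n} (G : Graph n) (X : VSet n) where
  private
    H : Graph (size X)
    H = induced G X
    el : Fin (size X) → Fin n
    el = enum X
    open StrictlyIncreasing el (enum-mono X)
    open ≡-Reasoning

  reach-induced : ∀ t i j → reachWithin G X t (el i) (el j) ≡ reachWithin H full t i j
  reach-induced zero    i j = cong₂ _∧_ (preserves-≟ i j) (enum-∈ X i)
  reach-induced (suc t) i j = cong₂ _∨_ (reach-induced t i j) (begin
      anyFin (λ w → reachWithin G X t (el i) w ∧ adj G w (el j) ∧ X (el j))
    ≡⟨ any-over-set X _ (λ w s → proj₂ (reach-inside G X t (el i) w (∧-conicalˡ _ _ s))) ⟩
      anyFin (λ l → reachWithin G X t (el i) (el l) ∧ adj G (el l) (el j) ∧ X (el j))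
    ≡⟨ anyFin-cong (λ l → cong₂ _∧_ (reach-induced t i l) (cong (adj G (el l) (el j) ∧_) (enum-∈ X j))) ⟩
      anyFin (λ l → reachWithin H full t i l ∧ adj H l j ∧ true)
    ∎)

  components-induced : components G X ≡ classCount (reachWithin H full n)
  components-induced = trans (count-over-set X _) (countFin-cong (λ i → cong not (begin
      anyFin (λ u → ⌊ u <? el i ⌋ ∧ connectedIn G X u (el i))
    ≡⟨ any-over-set X _ (λ u s → proj₁ (reach-inside G X n u (el i) (∧-conicalʳ _ _ s))) ⟩
      anyFin (λ l → ⌊ el l <? el i ⌋ ∧ connectedIn G X (el l) (el i))
    ≡⟨ anyFin-cong (λ l → cong₂ _∧_ (preserves-< l i) (reach-induced n l i)) ⟩
      anyFin (λ l → ⌊ l <? i ⌋ ∧ reachWithin H full n l i)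
    ∎)))

  degreeSum-induced : ∀ f → degreeSum f G X ≡ sum (λ i → f (degree H i))
  degreeSum-induced f = trans (sum-over-set X _) (sum-cong-≗ (λ i → cong f (count-over-set X (adj G (el i)))))

record SameAdj {k} (H H′ : Graph k) : Set where
  constructor same-adj
  field adj≡ : ∀ u v → adj H u v ≡ adj H′ u v
open SameAdj

reach-cong : ∀ {k} {H H′ : Graph k} → SameAdj H H′ →
  ∀ X t u v → reachWithin H X t u v ≡ reachWithin H′ X t u v
reach-cong e X zero    u v = refl
reach-cong e X (suc t) u v = cong₂ _∨_ (reach-cong e X t u v)
  (anyFin-cong (λ w → cong₂ _∧_ (reach-cong e X t u w) (cong (_∧ X v) (adj≡ e w v))))

degree-cong : ∀ {k} {H H′ : Graph k} → SameAdj H H′ → ∀ v → degree H v ≡ degree H′ v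
degree-cong e v = countFin-cong (adj≡ e v)

classCount-cong : ∀ {k} {r r′ : Fin k → Fin k → Bool} → (∀ u v → r u v ≡ r′ u v) → classCount r ≡ classCount r′
classCount-cong e = countFin-cong (λ v → cong not (anyFin-cong (λ u → cong (⌊ u <? v ⌋ ∧_) (e u v))))

reach-stable : ∀ {k} (H : Graph k) X {s} → (∀ u v → reachWithin H X (suc s) u v ≡ reachWithin H X s u v) →
  ∀ {t} → s ≤′ t → ∀ u v → reachWithin H X t u v ≡ reachWithin H X s u v
reach-stable H X settled ≤′-refl        u v = refl
reach-stable H X settled (≤′-step s≤′t) u v = trans (cong₂ _∨_ (reach-stable H X settled s≤′t u v)
  (anyFin-cong (λ w → cong (_∧ _) (reach-stable H X settled s≤′t u w)))) (settled u v)

classCount-settled : ∀ {k} {H H′ : Graph k} → SameAdj H H′ → ∀ {s} →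
  (∀ u v → reachWithin H′ full (suc s) u v ≡ reachWithin H′ full s u v) →
  ∀ {t} → s ≤ t → classCount (reachWithin H full t) ≡ classCount (reachWithin H′ full s)
classCount-settled {H′ = H′} e settled {t} s≤t = classCount-cong (λ u v →
  trans (reach-cong e full t u v) (reach-stable H′ full settled (≤⇒≤′ s≤t) u v))

by-evaluation : ∀ {k} (A B : Fin k → Fin k → Bool) →
  True (all? (λ u → all? (λ v → A u v ≟ᵇ B u v))) → ∀ u v → A u v ≡ B u v
by-evaluation A B ok = toWitness ok

graph2 : Bool → Graph 2
graph2 x = record { adj = adj2 ; sym = sym2 ; irrefl = λ { 0F → refl ; 1F → refl } }
  where
  adj2 : Fin 2 → Fin 2 → Bool
  adj2 0F 0F = false
  adj2 0F 1F = x
  adj2 1F 0F = x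
  adj2 1F 1F = false
  sym2 : ∀ u v → adj2 u v ≡ adj2 v u
  sym2 0F 0F = refl
  sym2 0F 1F = refl
  sym2 1F 0F = refl
  sym2 1F 1F = refl

graph2-of : (H : Graph 2) → SameAdj H (graph2 (adj H 0F 1F))
graph2-of H = same-adj agree
  where
  agree : ∀ u v → adj H u v ≡ adj (graph2 (adj H 0F 1F)) u v
  agree 0F 0F = irrefl H 0F
  agree 0F 1F = refl
  agree 1F 0F = adj-sym H 1F 0F
  agree 1F 1F = irrefl H 1F

graph3 : Bool → Bool → Bool → Graph 3
graph3 x y z = record { adj = adj3 ; sym = sym3 ; irrefl = λ { 0F → refl ; 1F → refl ; 2F → refl } }
  where
  adj3 : Fin 3 → Fin 3 → Bool
  adj3 0F 0F = false
  adj3 0F 1F = x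
  adj3 0F 2F = y
  adj3 1F 0F = x
  adj3 1F 1F = false
  adj3 1F 2F = z
  adj3 2F 0F = y
  adj3 2F 1F = z
  adj3 2F 2F = false
  sym3 : ∀ u v → adj3 u v ≡ adj3 v u
  sym3 0F 0F = refl
  sym3 0F 1F = refl
  sym3 0F 2F = refl
  sym3 1F 0F = refl
  sym3 1F 1F = refl
  sym3 1F 2F = refl
  sym3 2F 0F = refl
  sym3 2F 1F = refl
  sym3 2F 2F = refl

graph3-of : (H : Graph 3) → SameAdj H (graph3 (adj H 0F 1F) (adj H 0F 2F) (adj H 1F 2F))
graph3-of H = same-adj agree
  where
  agree : ∀ u v → adj H u v ≡ adj (graph3 (adj H 0F 1F) (adj H 0F 2F) (adj H 1F 2F)) u v
  agree 0F 0F = irrefl H 0F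
  agree 0F 1F = refl
  agree 0F 2F = refl
  agree 1F 0F = adj-sym H 1F 0F
  agree 1F 1F = irrefl H 1F
  agree 1F 2F = refl
  agree 2F 0F = adj-sym H 2F 0F
  agree 2F 1F = adj-sym H 2F 1F
  agree 2F 2F = irrefl H 2F

graph2-settled : ∀ x u v → reachWithin (graph2 x) full 2 u v ≡ reachWithin (graph2 x) full 1 u v
graph2-settled true  = by-evaluation _ _ _
graph2-settled false = by-evaluation _ _ _

graph3-settled : ∀ x y z u v → reachWithin (graph3 x y z) full 3 u v ≡ reachWithin (graph3 x y z) full 2 u v
graph3-settled true  true  true  = by-evaluation _ _ _
graph3-settled true  true  false = by-evaluation _ _ _
graph3-settled true  false true  = by-evaluation _ _ _
graph3-settled true  false false = by-evaluation _ _ _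
graph3-settled false true  true  = by-evaluation _ _ _
graph3-settled false true  false = by-evaluation _ _ _
graph3-settled false false true  = by-evaluation _ _ _
graph3-settled false false false = by-evaluation _ _ _

single-identity : (H : Graph 1) (t : ℕ) → classCount (reachWithin H full t) ≡ 1
single-identity H t = refl

pair-identity : (H : Graph 2) (t : ℕ) → 1 ≤ t →
  sum (degree H) ≡ 2 * ⟦ classCount (reachWithin H full t) ≡ᵇ 1 ⟧
pair-identity H t 1≤t = begin
    sum (degree H)
  ≡⟨ sum-cong-≗ (degree-cong (graph2-of H)) ⟩
    sum (degree (graph2 x))
  ≡⟨ on-graph2 x ⟩
    2 * ⟦ classCount (reachWithin (graph2 x) full 1) ≡ᵇ 1 ⟧
  ≡⟨ cong (λ c → 2 * ⟦ c ≡ᵇ 1 ⟧) (classCount-settled (graph2-of H) (graph2-settled x) 1≤t) ⟨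
    2 * ⟦ classCount (reachWithin H full t) ≡ᵇ 1 ⟧
  ∎
  where
  open ≡-Reasoning
  x : Bool
  x = adj H 0F 1F
  on-graph2 : ∀ x → sum (degree (graph2 x)) ≡ 2 * ⟦ classCount (reachWithin (graph2 x) full 1) ≡ᵇ 1 ⟧
  on-graph2 true  = refl
  on-graph2 false = refl

triple-identity : (H : Graph 3) (t : ℕ) → 2 ≤ t →
  sum (λ v → degree H v C 2) + 2 * ⟦ classCount (reachWithin H full t) ≡ᵇ 2 ⟧
    + 3 * ⟦ classCount (reachWithin H full t) ≡ᵇ 1 ⟧ ≡ sum (degree H)
triple-identity H t 2≤t = begin
    sum (λ v → degree H v C 2) + 2 * ⟦ c ≡ᵇ 2 ⟧ + 3 * ⟦ c ≡ᵇ 1 ⟧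
  ≡⟨ cong₂ (λ s c → s + 2 * ⟦ c ≡ᵇ 2 ⟧ + 3 * ⟦ c ≡ᵇ 1 ⟧)
       (sum-cong-≗ (λ v → cong (_C 2) (degree-cong same v)))
       (classCount-settled same (graph3-settled x y z) 2≤t) ⟩
    sum (λ v → degree H′ v C 2) + 2 * ⟦ c′ ≡ᵇ 2 ⟧ + 3 * ⟦ c′ ≡ᵇ 1 ⟧
  ≡⟨ on-graph3 x y z ⟩
    sum (degree H′)
  ≡⟨ sum-cong-≗ (degree-cong same) ⟨
    sum (degree H)
  ∎
  where
  open ≡-Reasoning
  x y z : Bool
  x = adj H 0F 1F
  y = adj H 0F 2F
  z = adj H 1F 2F
  H′ : Graph 3
  H′ = graph3 x y z
  same : SameAdj H H′
  same = graph3-of H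
  c c′ : ℕ
  c  = classCount (reachWithin H full t)
  c′ = classCount (reachWithin H′ full 2)
  on-graph3 : ∀ x y z → let G₃ = graph3 x y z ; k = classCount (reachWithin G₃ full 2) in
    sum (λ v → degree G₃ v C 2) + 2 * ⟦ k ≡ᵇ 2 ⟧ + 3 * ⟦ k ≡ᵇ 1 ⟧ ≡ sum (degree G₃)
  on-graph3 true  true  true  = refl
  on-graph3 true  true  false = refl
  on-graph3 true  false true  = refl
  on-graph3 true  false false = refl
  on-graph3 false true  true  = refl
  on-graph3 false true  false = refl
  on-graph3 false false true  = refl
  on-graph3 false false false = refl

subsetSum : ∀ {n} → (VSet n → ℕ) → ℕ
subsetSum {n} F = sumList (map F (subsets n))

-- A list sum is the vector sum along lookup, so subset sums inherit the
-- library's algebra of finite sums.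
sumList-as-sum : ∀ {A : Set} (F : A → ℕ) (l : List A) → sumList (map F l) ≡ sum (F ∘ lookup l)
sumList-as-sum F []      = refl
sumList-as-sum F (x ∷ l) = cong (F x +_) (sumList-as-sum F l)

subsetSum-cong : ∀ {n} {F F′ : VSet n → ℕ} → (∀ X → F X ≡ F′ X) → subsetSum F ≡ subsetSum F′
subsetSum-cong {n} e = cong sumList (map-cong e (subsets n))

subsetSum-zero : ∀ {n} → subsetSum {n} (λ _ → 0) ≡ 0
subsetSum-zero {n} = trans (sumList-as-sum (λ _ → 0) (subsets n)) (sum-replicate-zero (length (subsets n)))

subsetSum-+ : ∀ {n} (F F′ : VSet n → ℕ) → subsetSum (λ X → F X + F′ X) ≡ subsetSum F + subsetSum F′
subsetSum-+ {n} F F′ = begin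
  subsetSum (λ X → F X + F′ X)                ≡⟨ sumList-as-sum _ (subsets n) ⟩
  sum (λ i → F (at i) + F′ (at i))            ≡⟨ ∑-distrib-+ (F ∘ at) (F′ ∘ at) ⟩
  sum (F ∘ at) + sum (F′ ∘ at)                ≡⟨ cong₂ _+_ (sumList-as-sum F (subsets n)) (sumList-as-sum F′ (subsets n)) ⟨
  subsetSum F + subsetSum F′                  ∎
  where
  open ≡-Reasoning
  at : Fin (length (subsets n)) → VSet n
  at = lookup (subsets n)

subsetSum-* : ∀ {n} (c : ℕ) (F : VSet n → ℕ) → subsetSum (λ X → c * F X) ≡ c * subsetSum F
subsetSum-* {n} c F = begin
  subsetSum (λ X → c * F X)     ≡⟨ sumList-as-sum _ (subsets n) ⟩
  sum (λ i → c * F (at i))      ≡⟨ *-distribˡ-sum c (F ∘ at) ⟨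
  c * sum (F ∘ at)              ≡⟨ cong (c *_) (sumList-as-sum F (subsets n)) ⟨
  c * subsetSum F               ∎
  where
  open ≡-Reasoning
  at : Fin (length (subsets n)) → VSet n
  at = lookup (subsets n)

subsetSum-comm : ∀ {n m} (F : Fin m → VSet n → ℕ) →
  subsetSum (λ X → sum (λ v → F v X)) ≡ sum (λ v → subsetSum (F v))
subsetSum-comm {n} F = begin
  subsetSum (λ X → sum (λ v → F v X))   ≡⟨ sumList-as-sum _ (subsets n) ⟩
  sum (λ i → sum (λ v → F v (at i)))    ≡⟨ ∑-comm (λ i v → F v (at i)) ⟩
  sum (λ v → sum (λ i → F v (at i)))    ≡⟨ sum-cong-≗ (λ v → sumList-as-sum (F v) (subsets n)) ⟨
  sum (λ v → subsetSum (F v))           ∎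
  where
  open ≡-Reasoning
  at : Fin (length (subsets n)) → VSet n
  at = lookup (subsets n)

-- subsets (suc n) lists every subset s of the last n vertices twice, without
-- and with vertex 0.  The two extension maps are local to Defs, so they are
-- inferred from the definitional unfolding of subsets: the equation is refl
-- at every use.
subsetSum-split : ∀ {n} {a b : VSet n → VSet (suc n)} (F : VSet (suc n) → ℕ) →
  subsets (suc n) ≡ concatMap (λ s → a s ∷ b s ∷ []) (subsets n) →
  subsetSum F ≡ subsetSum (F ∘ a) + subsetSum (F ∘ b)
subsetSum-split {n} {a} {b} F unfold rewrite unfold = split (subsets n)
  where
  split : ∀ l → sumList (map F (concatMap (λ s → a s ∷ b s ∷ []) l))
              ≡ sumList (map (F ∘ a) l) + sumList (map (F ∘ b) l)
  split []      = refl
  split (s ∷ l) = trans (cong (λ r → F (a s) + (F (b s) + r)) (split l)) (interchange (F (a s)) (F (b s)) _ _)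
    where
    interchange : ∀ p q r t → p + (q + (r + t)) ≡ (p + r) + (q + t)
    interchange = solve-∀

onLevel : ∀ {n} → ℕ → (VSet n → ℕ) → VSet n → ℕ
onLevel k F X = if size X ≡ᵇ k then F X else 0

onLevel-cong : ∀ {n} k {F F′ : VSet n → ℕ} → (∀ X → size X ≡ k → F X ≡ F′ X) →
  ∀ X → onLevel k F X ≡ onLevel k F′ X
onLevel-cong k e X with size X ≡ᵇ k in level
... | true  = e X (≡ᵇ⇒≡ (size X) k (subst T (sym level) tt))
... | false = refl

levelSum : ∀ {n} → ℕ → (ℕ → ℕ) → VSet n → ℕ
levelSum k f S = subsetSum (onLevel k (λ Y → f (common Y S)))

levelSum-zero : ∀ {n} (f : ℕ → ℕ) (S : VSet n) → levelSum 0 f S ≡ f 0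
levelSum-zero {zero}  f S = +-identityʳ (f 0)
levelSum-zero {suc n} f S = trans (subsetSum-split {n} _ refl)
  (trans (cong₂ _+_ (levelSum-zero f (S ∘ suc)) (subsetSum-zero {n})) (+-identityʳ (f 0)))

levelSum-suc : ∀ {n} k (f : ℕ → ℕ) (S : VSet (suc n)) →
  levelSum (suc k) f S ≡ levelSum (suc k) f (S ∘ suc) + levelSum k (λ m → f (⟦ S zero ⟧ + m)) (S ∘ suc)
levelSum-suc {n} k f S = subsetSum-split {n} _ refl

levelSum-+ : ∀ {n} k (f g : ℕ → ℕ) (S : VSet n) → levelSum k (λ m → f m + g m) S ≡ levelSum k f S + levelSum k g S
levelSum-+ {n} k f g S = trans (subsetSum-cong split-if) (subsetSum-+ {n} _ _)
  where
  split-if : ∀ Y → onLevel k (λ Y → f (common Y S) + g (common Y S)) Y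
                 ≡ onLevel k (λ Y → f (common Y S)) Y + onLevel k (λ Y → g (common Y S)) Y
  split-if Y with size Y ≡ᵇ k
  ... | true  = refl
  ... | false = refl

levelSum-const : ∀ {n} (c : ℕ) (S : VSet n) → levelSum 1 (λ _ → c) S ≡ n * c
levelSum-const {zero}  c S = refl
levelSum-const {suc n} c S = trans (levelSum-suc 0 (λ _ → c) S)
  (trans (cong₂ _+_ (levelSum-const c (S ∘ suc)) (levelSum-zero (λ _ → c) (S ∘ suc))) (+-comm (n * c) c))

levelSum-singletons : ∀ {n} (S : VSet n) → levelSum 1 (λ m → m) S ≡ countFin S
levelSum-singletons {zero}  S = refl
levelSum-singletons {suc n} S = trans (levelSum-suc 0 (λ m → m) S)
  (trans (cong₂ _+_ (levelSum-singletons (S ∘ suc))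
                    (trans (levelSum-zero (⟦ S zero ⟧ +_) (S ∘ suc)) (+-identityʳ ⟦ S zero ⟧)))
         (+-comm (countFin (S ∘ suc)) ⟦ S zero ⟧))

levelSum-pairs : ∀ {n} (S : VSet n) → levelSum 2 (λ m → m) S + countFin S ≡ countFin S * n
levelSum-pairs {zero}  S = refl
levelSum-pairs {suc n} S = begin
    levelSum 2 (λ m → m) S + (b + c)
  ≡⟨ cong (_+ (b + c)) (trans (levelSum-suc 1 (λ m → m) S) (cong (levelSum 2 (λ m → m) S′ +_) shifted)) ⟩
    levelSum 2 (λ m → m) S′ + (n * b + c) + (b + c)
  ≡⟨ regroup (levelSum 2 (λ m → m) S′) b c n (levelSum-pairs S′) ⟩
    (b + c) * suc n
  ∎
  where
  open ≡-Reasoning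
  S′ : VSet n
  S′ = S ∘ suc
  b c : ℕ
  b = ⟦ S zero ⟧
  c = countFin S′
  shifted : levelSum 1 (λ m → b + m) S′ ≡ n * b + c
  shifted = trans (levelSum-+ 1 (λ _ → b) (λ m → m) S′) (cong₂ _+_ (levelSum-const b S′) (levelSum-singletons S′))
  regroup : ∀ p b c n → p + c ≡ c * n → p + (n * b + c) + (b + c) ≡ (b + c) * suc n
  regroup p b c n IH = trans (reorder p b c n) (trans (cong (λ q → q + n * b + b + c) IH) (expand b c n))
    where
    reorder : ∀ p b c n → p + (n * b + c) + (b + c) ≡ (p + c) + n * b + b + c
    reorder = solve-∀
    expand : ∀ b c n → c * n + n * b + b + c ≡ (b + c) * suc n
    expand = solve-∀

C2-suc : ∀ m → suc m C 2 ≡ m + m C 2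
C2-suc m = trans (sym (nCk+nC[k+1]≡[n+1]C[k+1] m 1)) (cong (_+ m C 2) (nC1≡n m))

levelSum-pairs-in-singletons : ∀ {n} (S : VSet n) → levelSum 1 (_C 2) S ≡ 0
levelSum-pairs-in-singletons {zero}  S = refl
levelSum-pairs-in-singletons {suc n} S = trans (levelSum-suc 0 (_C 2) S)
  (trans (cong₂ _+_ (levelSum-pairs-in-singletons (S ∘ suc)) (levelSum-zero (λ m → (⟦ S zero ⟧ + m) C 2) (S ∘ suc))) (no-pair (S zero)))
  where
  no-pair : ∀ b → 0 + (⟦ b ⟧ + 0) C 2 ≡ 0
  no-pair true  = refl
  no-pair false = refl

levelSum-pairs-in-pairs : ∀ {n} (S : VSet n) → levelSum 2 (_C 2) S ≡ countFin S C 2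
levelSum-pairs-in-pairs {zero}  S = refl
levelSum-pairs-in-pairs {suc n} S = trans (levelSum-suc 1 (_C 2) S)
  (trans (cong (_+ levelSum 1 (λ m → (⟦ S zero ⟧ + m) C 2) S′) (levelSum-pairs-in-pairs S′)) (with-vertex0 (S zero)))
  where
  S′ : VSet n
  S′ = S ∘ suc
  c : ℕ
  c = countFin S′
  with-vertex0 : ∀ b → c C 2 + levelSum 1 (λ m → (⟦ b ⟧ + m) C 2) S′ ≡ (⟦ b ⟧ + c) C 2
  with-vertex0 false = trans (cong (c C 2 +_) (levelSum-pairs-in-singletons S′)) (+-identityʳ (c C 2))
  with-vertex0 true  = begin
      c C 2 + levelSum 1 (λ m → suc m C 2) S′
    ≡⟨ cong (c C 2 +_) (subsetSum-cong (onLevel-cong 1 (λ Y _ → C2-suc (common Y S′)))) ⟩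
      c C 2 + levelSum 1 (λ m → m + m C 2) S′
    ≡⟨ cong (c C 2 +_) (levelSum-+ 1 (λ m → m) (_C 2) S′) ⟩
      c C 2 + (levelSum 1 (λ m → m) S′ + levelSum 1 (_C 2) S′)
    ≡⟨ cong (λ q → c C 2 + (q + levelSum 1 (_C 2) S′)) (levelSum-singletons S′) ⟩
      c C 2 + (c + levelSum 1 (_C 2) S′)
    ≡⟨ cong (λ q → c C 2 + (c + q)) (levelSum-pairs-in-singletons S′) ⟩
      c C 2 + (c + 0)
    ≡⟨ trans (cong (c C 2 +_) (+-identityʳ c)) (+-comm (c C 2) c) ⟩
      c + c C 2
    ≡⟨ C2-suc c ⟨
      suc c C 2
    ∎
    where open ≡-Reasoning

-- A set containing v is not empty.
through-empty : ∀ {n} (v : Fin n) (F : VSet n → ℕ) →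
  subsetSum (λ X → if X v then onLevel 0 F X else 0) ≡ 0
through-empty {suc n} zero    F = trans (subsetSum-split {n} _ refl)
  (cong₂ _+_ (subsetSum-zero {n}) (subsetSum-zero {n}))
through-empty {suc n} (suc v) F = trans (subsetSum-split {n} _ refl)
  (cong₂ _+_ (through-empty v _) (trans (subsetSum-cong (λ s → if-0 (s v))) (subsetSum-zero {n})))
  where
  if-0 : ∀ b → (if b then 0 else 0) ≡ 0
  if-0 true  = refl
  if-0 false = refl

-- The (k+1)-sets through a vertex v ∉ S correspond to the k-sets of the other
-- vertices, with the same intersection with S.
levelSum-through : ∀ {n} (v : Fin (suc n)) (S : VSet (suc n)) → S v ≡ false → ∀ k (f : ℕ → ℕ) →
  subsetSum (λ X → if X v then onLevel (suc k) (λ Y → f (common Y S)) X else 0) ≡ levelSum k f (S ∘ punchIn v)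
levelSum-through {n} zero S v∉S k f = trans (subsetSum-split {n} _ refl)
  (cong₂ _+_ (subsetSum-zero {n}) (cong (λ b → levelSum k (λ m → f (⟦ b ⟧ + m)) (S ∘ suc)) v∉S))
levelSum-through {suc n} (suc v) S v∉S zero f = trans (subsetSum-split {suc n} _ refl)
  (trans (cong₂ _+_ (levelSum-through v (S ∘ suc) v∉S zero f) (through-empty v _))
  (trans (+-identityʳ _) (trans (levelSum-zero f (S ∘ suc ∘ punchIn v)) (sym (levelSum-zero f (S ∘ punchIn (suc v)))))))
levelSum-through {suc n} (suc v) S v∉S (suc k) f = trans (subsetSum-split {suc n} _ refl)
  (trans (cong₂ _+_ (levelSum-through v (S ∘ suc) v∉S (suc k) f)
                    (levelSum-through v (S ∘ suc) v∉S k (λ m → f (⟦ S zero ⟧ + m))))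
  (sym (levelSum-suc k f (S ∘ punchIn (suc v)))))

double-count : ∀ {n} (G : Graph (suc n)) k (f : ℕ → ℕ) →
  subsetSum (onLevel (suc k) (degreeSum f G)) ≡ sum (λ v → levelSum k f (adj G v ∘ punchIn v))
double-count {n} G k f = begin
    subsetSum (onLevel (suc k) (degreeSum f G))
  ≡⟨ subsetSum-cong (λ X → level-inside (size X ≡ᵇ suc k) (through X)) ⟩
    subsetSum (λ X → sum (λ v → onLevel (suc k) (λ Y → through Y v) X))
  ≡⟨ subsetSum-comm (λ v X → onLevel (suc k) (λ Y → through Y v) X) ⟩
    sum (λ v → subsetSum (λ X → onLevel (suc k) (λ Y → through Y v) X))
  ≡⟨ sum-cong-≗ (λ v → subsetSum-cong (λ X → swap-ifs (size X ≡ᵇ suc k) (X v) {f (common X (adj G v))})) ⟩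
    sum (λ v → subsetSum (λ X → if X v then onLevel (suc k) (λ Y → f (common Y (adj G v))) X else 0))
  ≡⟨ sum-cong-≗ (λ v → levelSum-through v (adj G v) (irrefl G v) k f) ⟩
    sum (λ v → levelSum k f (adj G v ∘ punchIn v))
  ∎
  where
  open ≡-Reasoning
  through : VSet (suc n) → Fin (suc n) → ℕ
  through X v = if X v then f (common X (adj G v)) else 0
  level-inside : ∀ b (h : Fin (suc n) → ℕ) → (if b then sum h else 0) ≡ sum (λ v → if b then h v else 0)
  level-inside true  h = refl
  level-inside false h = sym (sum-replicate-zero (suc n))
  swap-ifs : ∀ b c {x : ℕ} → (if b then (if c then x else 0) else 0) ≡ (if c then (if b then x else 0) else 0)
  swap-ifs true  c     = refl
  swap-ifs false true  = refl
  swap-ifs false false = refl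

count-punched : ∀ {n} (v : Fin (suc n)) (S : VSet (suc n)) → S v ≡ false → countFin (S ∘ punchIn v) ≡ countFin S
count-punched zero            S v∉S = cong (λ b → ⟦ b ⟧ + countFin (S ∘ suc)) (sym v∉S)
count-punched {suc n} (suc v) S v∉S = cong (⟦ S zero ⟧ +_) (count-punched v (S ∘ suc) v∉S)

degree-punched : ∀ {n} (G : Graph (suc n)) v → countFin (adj G v ∘ punchIn v) ≡ degree G v
degree-punched G v = count-punched v (adj G v) (irrefl G v)

pairs-degreeSum : ∀ {n} (G : Graph (suc n)) → subsetSum (onLevel 2 (degreeSum (λ m → m) G)) ≡ sum (degree G)
pairs-degreeSum G = trans (double-count G 1 (λ m → m))
  (sum-cong-≗ (λ v → trans (levelSum-singletons (adj G v ∘ punchIn v)) (degree-punched G v)))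

triples-degreeSum : ∀ {n} (G : Graph (suc n)) →
  subsetSum (onLevel 3 (degreeSum (λ m → m) G)) + sum (degree G) ≡ sum (degree G) * n
triples-degreeSum {n} G = begin
    subsetSum (onLevel 3 (degreeSum (λ m → m) G)) + sum (degree G)
  ≡⟨ cong (_+ sum (degree G)) (double-count G 2 (λ m → m)) ⟩
    sum (λ v → levelSum 2 (λ m → m) (nbhd v)) + sum (degree G)
  ≡⟨ ∑-distrib-+ (λ v → levelSum 2 (λ m → m) (nbhd v)) (degree G) ⟨
    sum (λ v → levelSum 2 (λ m → m) (nbhd v) + degree G v)
  ≡⟨ sum-cong-≗ (λ v → trans (cong (levelSum 2 (λ m → m) (nbhd v) +_) (sym (degree-punched G v)))
                        (trans (levelSum-pairs (nbhd v)) (cong (_* n) (degree-punched G v)))) ⟩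
    sum (λ v → degree G v * n)
  ≡⟨ *-distribʳ-sum n (degree G) ⟨
    sum (degree G) * n
  ∎
  where
  open ≡-Reasoning
  nbhd : Fin (suc n) → VSet n
  nbhd v = adj G v ∘ punchIn v

triples-pairSum : ∀ {n} (G : Graph (suc n)) → subsetSum (onLevel 3 (degreeSum (_C 2) G)) ≡ sum (λ v → degree G v C 2)
triples-pairSum G = trans (double-count G 2 (_C 2))
  (sum-cong-≗ (λ v → trans (levelSum-pairs-in-pairs (adj G v ∘ punchIn v)) (cong (_C 2) (degree-punched G v))))

length-filter : ∀ {A : Set} {P : A → Set} (P? : ∀ x → Dec (P x)) (l : List A) →
  length (filter P? l) ≡ sumList (map (λ x → ⟦ does (P? x) ⟧) l)
length-filter P? []      = refl
length-filter P? (x ∷ l) with does (P? x)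
... | true  = cong suc (length-filter P? l)
... | false = length-filter P? l

Qcoeff-as-sum : ∀ {n} (G : Graph n) i j → Qcoeff G i j ≡ subsetSum (onLevel i (λ X → ⟦ components G X ≡ᵇ j ⟧))
Qcoeff-as-sum {n} G i j = trans (length-filter _ (subsets n)) (subsetSum-cong {n} (λ X → ⟦∧⟧ (size X ≡ᵇ i)))

module SmallSets {n} (G : Graph n) (X : VSet n) where
  open InducedSubgraph G X

  private
    at-most-n : ∀ {k} → size X ≡ k → k ≤ n
    at-most-n eq = subst (_≤ n) eq (size≤ X)

  singleton-components : size X ≡ 1 → components G X ≡ 1
  singleton-components eq = trans components-induced (on-one eq (induced G X))
    where
    on-one : ∀ {k} → k ≡ 1 → (H : Graph k) → classCount (reachWithin H full n) ≡ 1
    on-one refl H = single-identity H n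

  pair-degreeSum : size X ≡ 2 → degreeSum (λ m → m) G X ≡ 2 * ⟦ components G X ≡ᵇ 1 ⟧
  pair-degreeSum eq = trans (degreeSum-induced (λ m → m))
    (trans (on-two eq (induced G X)) (cong (λ c → 2 * ⟦ c ≡ᵇ 1 ⟧) (sym components-induced)))
    where
    on-two : ∀ {k} → k ≡ 2 → (H : Graph k) → sum (degree H) ≡ 2 * ⟦ classCount (reachWithin H full n) ≡ᵇ 1 ⟧
    on-two refl H = pair-identity H n (≤-trans (n≤1+n 1) (at-most-n eq))

  triple-degreeSum : size X ≡ 3 →
    degreeSum (_C 2) G X + 2 * ⟦ components G X ≡ᵇ 2 ⟧ + 3 * ⟦ components G X ≡ᵇ 1 ⟧ ≡ degreeSum (λ m → m) G X
  triple-degreeSum eq = trans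
    (cong₂ (λ s c → s + 2 * ⟦ c ≡ᵇ 2 ⟧ + 3 * ⟦ c ≡ᵇ 1 ⟧) (degreeSum-induced (_C 2)) components-induced)
    (trans (on-three eq (induced G X)) (sym (degreeSum-induced (λ m → m))))
    where
    on-three : ∀ {k} → k ≡ 3 → (H : Graph k) →
      let c = classCount (reachWithin H full n) in
      sum (λ i → degree H i C 2) + 2 * ⟦ c ≡ᵇ 2 ⟧ + 3 * ⟦ c ≡ᵇ 1 ⟧ ≡ sum (degree H)
    on-three refl H = triple-identity H n (≤-trans (n≤1+n 2) (at-most-n eq))

open SmallSets

Q-vertices : ∀ {n} (G : Graph n) → Qcoeff G 1 1 ≡ n
Q-vertices {n} G = begin
    Qcoeff G 1 1
  ≡⟨ Qcoeff-as-sum G 1 1 ⟩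
    subsetSum (onLevel 1 (λ X → ⟦ components G X ≡ᵇ 1 ⟧))
  ≡⟨ subsetSum-cong {n} (onLevel-cong 1 (λ X eq → cong (λ c → ⟦ c ≡ᵇ 1 ⟧) (singleton-components G X eq))) ⟩
    levelSum 1 (λ _ → 1) (full {n})
  ≡⟨ levelSum-const 1 (full {n}) ⟩
    n * 1
  ≡⟨ *-identityʳ n ⟩
    n
  ∎
  where open ≡-Reasoning

Q-degrees : ∀ {n} (G : Graph (suc n)) → sum (degree G) ≡ 2 * Qcoeff G 2 1
Q-degrees {n} G = begin
    sum (degree G)
  ≡⟨ pairs-degreeSum G ⟨
    subsetSum (onLevel 2 (degreeSum (λ m → m) G))
  ≡⟨ subsetSum-cong pair-level ⟩
    subsetSum (λ X → 2 * onLevel 2 connected X)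
  ≡⟨ subsetSum-* 2 (onLevel 2 connected) ⟩
    2 * subsetSum (onLevel 2 connected)
  ≡⟨ cong (2 *_) (Qcoeff-as-sum G 2 1) ⟨
    2 * Qcoeff G 2 1
  ∎
  where
  open ≡-Reasoning
  connected : VSet (suc n) → ℕ
  connected X = ⟦ components G X ≡ᵇ 1 ⟧
  pair-level : ∀ X → onLevel 2 (degreeSum (λ m → m) G) X ≡ 2 * onLevel 2 connected X
  pair-level X with size X ≡ᵇ 2 in level
  ... | true  = pair-degreeSum G X (≡ᵇ⇒≡ (size X) 2 (subst T (sym level) tt))
  ... | false = refl

Q-triples : ∀ {n} (G : Graph (suc n)) →
  sum (λ v → degree G v C 2) + 2 * Qcoeff G 3 2 + 3 * Qcoeff G 3 1 ≡ subsetSum (onLevel 3 (degreeSum (λ m → m) G))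
Q-triples {n} G = begin
    sum (λ v → degree G v C 2) + 2 * Qcoeff G 3 2 + 3 * Qcoeff G 3 1
  ≡⟨ cong₂ _+_ (cong₂ _+_ (sym (triples-pairSum G)) (cong (2 *_) (Qcoeff-as-sum G 3 2))) (cong (3 *_) (Qcoeff-as-sum G 3 1)) ⟩
    subsetSum F₁ + 2 * subsetSum F₂ + 3 * subsetSum F₃
  ≡⟨ cong₂ _+_ (cong (subsetSum F₁ +_) (subsetSum-* 2 F₂)) (subsetSum-* 3 F₃) ⟨
    subsetSum F₁ + subsetSum (λ X → 2 * F₂ X) + subsetSum (λ X → 3 * F₃ X)
  ≡⟨ cong (_+ subsetSum (λ X → 3 * F₃ X)) (subsetSum-+ F₁ (λ X → 2 * F₂ X)) ⟨
    subsetSum (λ X → F₁ X + 2 * F₂ X) + subsetSum (λ X → 3 * F₃ X)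
  ≡⟨ subsetSum-+ (λ X → F₁ X + 2 * F₂ X) (λ X → 3 * F₃ X) ⟨
    subsetSum (λ X → F₁ X + 2 * F₂ X + 3 * F₃ X)
  ≡⟨ subsetSum-cong triple-level ⟩
    subsetSum (onLevel 3 (degreeSum (λ m → m) G))
  ∎
  where
  open ≡-Reasoning
  F₁ F₂ F₃ : VSet (suc n) → ℕ
  F₁ = onLevel 3 (degreeSum (_C 2) G)
  F₂ = onLevel 3 (λ X → ⟦ components G X ≡ᵇ 2 ⟧)
  F₃ = onLevel 3 (λ X → ⟦ components G X ≡ᵇ 1 ⟧)
  triple-level : ∀ X → F₁ X + 2 * F₂ X + 3 * F₃ X ≡ onLevel 3 (degreeSum (λ m → m) G) X
  triple-level X with size X ≡ᵇ 3 in level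
  ... | true  = triple-degreeSum G X (≡ᵇ⇒≡ (size X) 3 (subst T (sym level) tt))
  ... | false = refl

Q-order : ∀ {n m} (G : Graph n) (H : Graph m) → SameQ H G → m ≡ n
Q-order G H same = trans (sym (Q-vertices H)) (trans (same 1 1) (Q-vertices G))

Q-degree-sum : ∀ {n} (G H : Graph (suc n)) → SameQ H G → sum (degree H) ≡ sum (degree G)
Q-degree-sum G H same = trans (Q-degrees H) (trans (cong (2 *_) (same 2 1)) (sym (Q-degrees G)))

Q-pair-sum : ∀ {n} (G H : Graph (suc n)) → SameQ H G → sum (λ v → degree H v C 2) ≡ sum (λ v → degree G v C 2)
Q-pair-sum {n} G H same = +-cancelʳ-≡ (2 * Qcoeff G 3 2) _ _ (+-cancelʳ-≡ (3 * Qcoeff G 3 1) _ _ (begin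
    sum (λ v → degree H v C 2) + 2 * Qcoeff G 3 2 + 3 * Qcoeff G 3 1
  ≡⟨ cong₂ (λ q₂ q₁ → sum (λ v → degree H v C 2) + 2 * q₂ + 3 * q₁) (same 3 2) (same 3 1) ⟨
    sum (λ v → degree H v C 2) + 2 * Qcoeff H 3 2 + 3 * Qcoeff H 3 1
  ≡⟨ Q-triples H ⟩
    triples H
  ≡⟨ +-cancelʳ-≡ (sum (degree G)) _ _ (begin
       triples H + sum (degree G)   ≡⟨ cong (triples H +_) (Q-degree-sum G H same) ⟨
       triples H + sum (degree H)   ≡⟨ triples-degreeSum H ⟩
       sum (degree H) * n           ≡⟨ cong (_* n) (Q-degree-sum G H same) ⟩
       sum (degree G) * n           ≡⟨ triples-degreeSum G ⟨
       triples G + sum (degree G)   ∎) ⟩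
    triples G
  ≡⟨ Q-triples G ⟨
    sum (λ v → degree G v C 2) + 2 * Qcoeff G 3 2 + 3 * Qcoeff G 3 1
  ∎))
  where
  open ≡-Reasoning
  triples : Graph (suc n) → ℕ
  triples K = subsetSum (onLevel 3 (degreeSum (λ m → m) K))

square-as-pairs : ∀ d → d * d ≡ d + 2 * (d C 2)
square-as-pairs zero    = refl
square-as-pairs (suc d) = begin
    suc d * suc d
  ≡⟨ expand d ⟩
    d * d + 2 * d + 1
  ≡⟨ cong (λ q → q + 2 * d + 1) (square-as-pairs d) ⟩
    d + 2 * (d C 2) + 2 * d + 1
  ≡⟨ regroup d (d C 2) ⟩
    suc d + 2 * (d + d C 2)
  ≡⟨ cong (λ q → suc d + 2 * q) (C2-suc d) ⟨
    suc d + 2 * (suc d C 2)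
  ∎
  where
  open ≡-Reasoning
  expand : ∀ d → suc d * suc d ≡ d * d + 2 * d + 1
  expand = solve-∀
  regroup : ∀ d p → d + 2 * p + 2 * d + 1 ≡ suc d + 2 * (d + p)
  regroup = solve-∀

square-gap : ∀ d k → Σ[ t ∈ ℕ ] (d * d + k * k ≡ 2 * k * d + t * t) × (t ≡ 0 → d ≡ k)
square-gap d k with ≤-total k d
... | inj₁ k≤d with t , refl ← m≤n⇒∃[o]m+o≡n k≤d = t , gap k t , λ { refl → +-identityʳ k }
  where
  gap : ∀ k t → (k + t) * (k + t) + k * k ≡ 2 * k * (k + t) + t * t
  gap = solve-∀
... | inj₂ d≤k with t , refl ← m≤n⇒∃[o]m+o≡n d≤k = t , gap d t , λ { refl → sym (+-identityʳ d) }
  where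
  gap : ∀ d t → d * d + (d + t) * (d + t) ≡ 2 * (d + t) * d + t * t
  gap = solve-∀

sum-const : ∀ N c → sum {N} (λ _ → c) ≡ N * c
sum-const zero    c = refl
sum-const (suc N) c = cong (c +_) (sum-const N c)

sum-zero : ∀ {N} (f : Fin N → ℕ) → sum f ≡ 0 → ∀ v → f v ≡ 0
sum-zero f Σf≡0 zero    = m+n≡0⇒m≡0 (f zero) Σf≡0
sum-zero f Σf≡0 (suc v) = sum-zero (f ∘ suc) (m+n≡0⇒n≡0 (f zero) Σf≡0) v

sum-of-squares : ∀ {N} (d : Fin N → ℕ) (k : ℕ) →
  sum d ≡ N * k → sum (λ v → d v C 2) ≡ N * (k C 2) → sum (λ v → d v * d v) ≡ N * (k * k)
sum-of-squares {N} d k Σd Σpairs = begin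
    sum (λ v → d v * d v)
  ≡⟨ sum-cong-≗ (square-as-pairs ∘ d) ⟩
    sum (λ v → d v + 2 * (d v C 2))
  ≡⟨ ∑-distrib-+ d (λ v → 2 * (d v C 2)) ⟩
    sum d + sum (λ v → 2 * (d v C 2))
  ≡⟨ cong (sum d +_) (*-distribˡ-sum 2 (λ v → d v C 2)) ⟨
    sum d + 2 * sum (λ v → d v C 2)
  ≡⟨ cong₂ (λ a b → a + 2 * b) Σd Σpairs ⟩
    N * k + 2 * (N * (k C 2))
  ≡⟨ factor N k (k C 2) ⟩
    N * (k + 2 * (k C 2))
  ≡⟨ cong (N *_) (square-as-pairs k) ⟨
    N * (k * k)
  ∎
  where
  open ≡-Reasoning
  factor : ∀ N k p → N * k + 2 * (N * p) ≡ N * (k + 2 * p)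
  factor = solve-∀

-- A family of N naturals with Σ d_v = N·k and Σ C(d_v,2) = N·C(k,2) is
-- constantly k: then Σ (d_v - k)² = Σ d_v² - 2k Σ d_v + N k² = 0.
constant-of-moments : ∀ {N} (d : Fin N → ℕ) (k : ℕ) →
  sum d ≡ N * k → sum (λ v → d v C 2) ≡ N * (k C 2) → ∀ v → d v ≡ k
constant-of-moments {N} d k Σd Σpairs v =
  proj₂ (proj₂ (gap v)) ([ id , id ]′ (m*n≡0⇒m≡0∨n≡0 (t v) (sum-zero (λ v → t v * t v) Σt² v)))
  where
  open ≡-Reasoning
  gap : ∀ v → Σ[ t ∈ ℕ ] (d v * d v + k * k ≡ 2 * k * d v + t * t) × (t ≡ 0 → d v ≡ k)
  gap v = square-gap (d v) k
  t : Fin N → ℕ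
  t v = proj₁ (gap v)
  Σt² : sum (λ v → t v * t v) ≡ 0
  Σt² = +-cancelˡ-≡ (sum (λ v → 2 * k * d v)) _ _ (begin
      sum (λ v → 2 * k * d v) + sum (λ v → t v * t v)
    ≡⟨ ∑-distrib-+ (λ v → 2 * k * d v) (λ v → t v * t v) ⟨
      sum (λ v → 2 * k * d v + t v * t v)
    ≡⟨ sum-cong-≗ (λ v → proj₁ (proj₂ (gap v))) ⟨
      sum (λ v → d v * d v + k * k)
    ≡⟨ ∑-distrib-+ (λ v → d v * d v) (λ _ → k * k) ⟩
      sum (λ v → d v * d v) + sum {N} (λ _ → k * k)
    ≡⟨ cong₂ _+_ (sum-of-squares d k Σd Σpairs) (sum-const N (k * k)) ⟩
      N * (k * k) + N * (k * k)
    ≡⟨ balance N k ⟩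
      2 * k * (N * k)
    ≡⟨ cong (2 * k *_) Σd ⟨
      2 * k * sum d
    ≡⟨ *-distribˡ-sum (2 * k) d ⟩
      sum (λ v → 2 * k * d v)
    ≡⟨ +-identityʳ _ ⟨
      sum (λ v → 2 * k * d v) + 0
    ∎)
    where
    balance : ∀ N k → N * (k * k) + N * (k * k) ≡ 2 * k * (N * k)
    balance = solve-∀

regular-of-same-Q : ∀ {n} (G H : Graph n) (k : ℕ) → Regular G k → SameQ H G → Regular H k
regular-of-same-Q {zero}  G H k regular same ()
regular-of-same-Q {suc n} G H k regular same = constant-of-moments (degree H) k
  (trans (Q-degree-sum G H same) (trans (sum-cong-≗ regular) (sum-const (suc n) k)))
  (trans (Q-pair-sum G H same) (trans (sum-cong-≗ (λ v → cong (_C 2) (regular v))) (sum-const (suc n) (k C 2))))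

proposition3p3 : ∀ {n m} (G : Graph n) (H : Graph m) (k : ℕ) →
    Regular G k → SameQ H G → Regular H k
proposition3p3 G H k regular same with Q-order G H same
... | refl = regular-of-same-Q G H k regular same
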